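{- Identify each arithmetical function $a:\mathbb{N}\to\mathbb{C}$ with the formal series $a(x_1,x_2,\dots)=\sum_{n\ge1}a(n)[\mathbf{x}]^n$. Then: (1) $a$ is multiplicative if and only if there are (unique) formal power series $f_i(x)\in\mathbb{C}[[x]]$ ($i\ge1$) with constant term $1$ such that $a(x_1,x_2,\dots)=\prod_{i=1}^\infty f_i(x_i)$. Moreover $a$ is completely multiplicative if and only if there are complex numbers $c_1,c_2,\dots$ such that $a(x_1,x_2,\dots)=\prod_{i=1}^\infty(1-c_ix_i)^{ -1}$, i.e. $a=u(c_1x_1,c_2x_2,\dots)$. (2) $a$ is additive if and only if there are (unique) formal power series $f_i(x)\in\mathbb{C}[[x]]$ with constant term $0$ such that $a(x_1,x_2,\dots)=u(x_1,x_2,\dots)\sum_{i=1}^\infty f_i(x_i)$. Moreover $a$ is completely additive if and only if there are complex numbers $c_1,c_2,\dots$ such that $a(x_1,x_2,\dots)=u(x_1,x_2,\dots)\sum_{i=1}^\infty \frac{c_ix_i}{1-x_i}$.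
   Context: Let $p_1=2,p_2=3,p_3,\dots$ be the primes in increasing order. For $n=p_1^{\alpha_1}\cdots p_k^{\alpha_k}\in\mathbb{N}$ write $[\mathbf{x}]^n=x_1^{\alpha_1}\cdots x_k^{\alpha_k}$. Let $\mathbb{A}$ be the ring of formal series $\sum_{n\ge1}a_n[\mathbf{x}]^n$ ($a_n\in\mathbb{C}$) in countably many variables, i.e. the completion of $\mathbb{C}[x_1,x_2,\dots]$ with respect to the valuation $v$ with $v(x_1^{\alpha_1}\cdots x_k^{\alpha_k})=p_1^{\alpha_1}\cdots p_k^{\alpha_k}$; infinite products and sums are taken as limits in this topology (a term contributes to the coefficient of $[\mathbf{x}]^n$ only if it involves monomials of value at most $n$). The map $a\mapsto\sum_n a(n)[\mathbf{x}]^n$ is a ring isomorphism from arithmetical functions (with pointwise sum and Dirichlet product $(a\star b)(n)=\sum_{d\mid n}a(d)b(n/d)$) onto $\mathbb{A}$. $u$ is the function $u(n)=1$ for all $n$, so $u(x_1,x_2,\dots)=\prod_{i\ge1}(1-x_i)^{ -1}$, and $u(c_1x_1,c_2x_2,\dots)$ means this series with $x_i$ replaced by $c_ix_i$. An arithmetical function $a$ is multiplicative if $a(1)=1$ and $a(mn)=a(m)a(n)$ for coprime $m,n$; completely multiplicative if $a(1)=1$ and $a(mn)=a(m)a(n)$ for all $m,n$; additive if $a(mn)=a(m)+a(n)$ for coprime $m,n$; completely additive if $a(mn)=a(m)+a(n)$ for all $m,n$. -}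

module Defs where

open import Level using (_⊔_)
open import Algebra.Bundles using (CommutativeRing)
open import Data.Nat as ℕ using (ℕ; zero; suc; _≤_; _^_)
open import Data.Nat.Divisibility using (_∣?_)
open import Data.Nat.DivMod using (_/_)
open import Data.Nat.Primality using (Prime; prime?)
open import Data.Nat.Coprimality using (Coprime)
open import Data.Product using (Σ; ∃; _×_)
open import Relation.Nullary using (yes; no)

_⟺_ : ∀ {a b} → Set a → Set b → Set (a ⊔ b)
A ⟺ B = (A → B) × (B → A)

module Series {c ℓ} (R : CommutativeRing c ℓ) where
  open CommutativeRing R

  -- An arithmetical function a, identified with the element Σ_{n≥1} a(n)[x]^n of 𝔸.
  -- Only the values at n ≥ 1 are meaningful; a 0 is ignored everywhere.
  Arith : Set c
  Arith = ℕ → Carrier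

  -- A one-variable formal power series in ℂ[[x]]: k ↦ coefficient of x^k.
  PS : Set c
  PS = ℕ → Carrier

  sumBelow : ℕ → (ℕ → Carrier) → Carrier
  sumBelow zero    g = 0#
  sumBelow (suc n) g = sumBelow n g + g n

  dirTerm : Arith → Arith → ℕ → ℕ → Carrier
  dirTerm a b n k with suc k ∣? n
  ... | yes _ = a (suc k) * b (n / suc k)
  ... | no  _ = 0#

  -- Dirichlet product (= product in 𝔸): (a ⋆ b)(n) = Σ_{d ∣ n} a(d) b(n/d)
  _⋆_ : Arith → Arith → Arith
  (a ⋆ b) n = sumBelow n (dirTerm a b n)

  _⊕_ : Arith → Arith → Arith
  (a ⊕ b) n = a n + b n

  -- the unit 1 of 𝔸 (coefficient 1 at [x]^1, else 0)
  δ : Arith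
  δ n with n ℕ.≟ 1
  ... | yes _ = 1#
  ... | no  _ = 0#

  𝟘 : Arith
  𝟘 n = 0#

  u : Arith
  u n = 1#

  -- f(x_p) ∈ 𝔸 for a power series f, the variable indexed by the prime p:
  -- coefficient f k at [x]^(p^k), 0 at all other n.
  powTerm : ℕ → PS → ℕ → ℕ → Carrier
  powTerm p f n k with p ^ k ℕ.≟ n
  ... | yes _ = f k
  ... | no  _ = 0#

  embed : ℕ → PS → Arith
  embed p f n = sumBelow (suc n) (powTerm p f n)

  partialProd : (ℕ → PS) → ℕ → Arith
  partialProd f zero = δ
  partialProd f (suc N) with prime? N
  ... | yes _ = partialProd f N ⋆ embed N (f N)
  ... | no  _ = partialProd f N

  partialSum : (ℕ → PS) → ℕ → Arith
  partialSum f zero = 𝟘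
  partialSum f (suc N) with prime? N
  ... | yes _ = partialSum f N ⊕ embed N (f N)
  ... | no  _ = partialSum f N

  _≋_ : Arith → Arith → Set ℓ
  a ≋ b = ∀ n → 1 ≤ n → a n ≈ b n

  -- convergence in the v-adic topology of 𝔸: every coefficient eventually stabilises at L's
  ConvergesTo : (ℕ → Arith) → Arith → Set ℓ
  ConvergesTo s L = ∀ n → 1 ≤ n → ∃ λ N₀ → ∀ N → N₀ ≤ N → s N n ≈ L n

  IsInfProd : (ℕ → PS) → Arith → Set ℓ
  IsInfProd f a = ConvergesTo (partialProd f) a

  IsUTimesSum : (ℕ → PS) → Arith → Set (c ⊔ ℓ)
  IsUTimesSum f a = Σ Arith λ S → ConvergesTo (partialSum f) S × (a ≋ (u ⋆ S))

  -- (1 - c x)^{-1} = Σ_k c^k x^k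
  pow : Carrier → ℕ → Carrier
  pow x zero    = 1#
  pow x (suc k) = x * pow x k

  geomPS : Carrier → PS
  geomPS x k = pow x k

  -- c x / (1 - x) = Σ_{k≥1} c x^k
  cxOver1-x : Carrier → PS
  cxOver1-x x zero    = 0#
  cxOver1-x x (suc k) = x

  Multiplicative : Arith → Set ℓ
  Multiplicative a = (a 1 ≈ 1#) ×
    (∀ m n → 1 ≤ m → 1 ≤ n → Coprime m n → a (m ℕ.* n) ≈ a m * a n)

  CompletelyMultiplicative : Arith → Set ℓ
  CompletelyMultiplicative a = (a 1 ≈ 1#) ×
    (∀ m n → 1 ≤ m → 1 ≤ n → a (m ℕ.* n) ≈ a m * a n)

  Additive : Arith → Set ℓ
  Additive a = ∀ m n → 1 ≤ m → 1 ≤ n → Coprime m n → a (m ℕ.* n) ≈ a m + a n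

  CompletelyAdditive : Arith → Set ℓ
  CompletelyAdditive a = ∀ m n → 1 ≤ m → 1 ≤ n → a (m ℕ.* n) ≈ a m + a n

module Submission where

-- The partial products Π_{p<N} f_p(x_p) and partial sums u · Σ_{p<N} f_p(x_p) are finite
-- Dirichlet products, and everything rests on one coefficient computation (⋆-embed): for
-- y = p^v·m with p ∤ m, the coefficient of b · g(x_p) at y is Σ_{j≤v} b(m·p^(v-j)) g(j).
-- From it we read off, for every N:
--   (a) the partial product is multiplicative, and u times the partial sum is additive, on
--       every pair of numbers whose p-exponents obey the corresponding exponent law of the
--       f_p; for coprime pairs this law only asks f_p(0) = 1 (resp. f_p(0) = 0), for all pairs
--       it is the law of 1/(1 - c x) (resp. of c x/(1 - x));
--   (b) once p < N, their coefficients at p^v are f_p(v), resp. f_p(0) + … + f_p(v).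
-- Two general facts about coefficientwise limits finish the proof: homomorphism laws pass to
-- limits (hom-limit), and a coprime-homomorphism is determined by its values at 1 and at prime
-- powers (hom-determined). Uniqueness of the f_p is (b) read backwards.

open import Defs
open import Algebra.Bundles using (CommutativeRing; Monoid)
open import Data.Nat using (ℕ)
open import Data.Nat.Primality using (Prime)
open import Data.Product using (Σ; _×_; _,_)

module PrimePowers where
  open import Data.Nat
  open import Data.Nat.Properties
  open import Data.Nat.Divisibility
  open import Data.Nat.Primality
  open import Data.Nat.Primality.Factorisation using (factorise)
  open import Data.Nat.Coprimality using (Coprime; coprime-divisor)
  open import Data.Nat.Induction using (<-rec)
  open import Data.Nat.Tactic.RingSolver using (solve-∀)
  open import Data.Product using (∃; _×_; _,_)
  open import Data.Sum using (_⊎_; inj₁; inj₂)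
  open import Data.Empty using (⊥-elim)
  open import Data.Unit using (⊤)
  open import Data.List using (_∷_)
  open import Data.List.Relation.Unary.All using (_∷_)
  open import Relation.Nullary using (¬_; yes; no)
  open import Relation.Binary.PropositionalEquality
  open import Relation.Binary.Definitions using (tri<; tri≈; tri>)

  prime≥2 : ∀ {p} → Prime p → 2 ≤ p
  prime≥2 {p} pp = nonTrivial⇒n>1 p {{prime⇒nonTrivial pp}}

  prime≥1 : ∀ {p} → Prime p → 1 ≤ p
  prime≥1 pp = <⇒≤ (prime≥2 pp)

  ¬prime∣1 : ∀ {p} → Prime p → ¬ p ∣ 1
  ¬prime∣1 pp p∣1 = <⇒≢ (prime≥2 pp) (sym (∣1⇒≡1 p∣1))

  ^-positive : ∀ {p} → 1 ≤ p → ∀ k → 1 ≤ p ^ k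
  ^-positive {suc p} _ k = m^n>0 (suc p) k

  ^-injective : ∀ {p} → 2 ≤ p → ∀ {i j} → p ^ i ≡ p ^ j → i ≡ j
  ^-injective {p} 2≤p {i} {j} eq with <-cmp i j
  ... | tri< i<j _ _ = ⊥-elim (<⇒≢ (^-monoʳ-< p 2≤p i<j) eq)
  ... | tri≈ _ i≡j _ = i≡j
  ... | tri> _ _ j<i = ⊥-elim (<⇒≢ (^-monoʳ-< p 2≤p j<i) (sym eq))

  exponent<power : ∀ {p} → 2 ≤ p → ∀ k → k < p ^ k
  exponent<power _ zero = s≤s z≤n
  exponent<power {p} 2≤p (suc k) = ≤-<-trans (exponent<power 2≤p k) (^-monoʳ-< p 2≤p (n<1+n k))

  base≤power : ∀ {p} → 1 ≤ p → ∀ k → p ≤ p ^ suc k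
  base≤power {p} 1≤p k = m≤m*n p (p ^ k) {{>-nonZero (^-positive 1≤p k)}}

  prime≤ : ∀ {p n} → Prime p → ∀ k → p ^ suc k ≤ n → p ≤ n
  prime≤ pp k p^[1+k]≤n = ≤-trans (base≤power (prime≥1 pp) k) p^[1+k]≤n

  *-power-positive : ∀ {p m} → 1 ≤ p → 1 ≤ m → ∀ e → 1 ≤ m * p ^ e
  *-power-positive 1≤p 1≤m e = *-mono-≤ 1≤m (^-positive 1≤p e)

  p∣p^[1+v]* : ∀ p v m → p ∣ p ^ suc v * m
  p∣p^[1+v]* p v m = ∣m⇒∣m*n m (m∣m*n (p ^ v))

  p∣*p^[v∸j] : ∀ p m {j v} → j < v → p ∣ m * p ^ (v ∸ j)
  p∣*p^[v∸j] p m {j} {suc v} (s≤s j≤v) =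
    subst (λ t → p ∣ m * p ^ t) (sym (+-∸-assoc 1 j≤v)) (∣n⇒∣m*n m (m∣m*n (p ^ (v ∸ j))))

  ¬∣-* : ∀ {p m n} → Prime p → ¬ p ∣ m → ¬ p ∣ n → ¬ p ∣ m * n
  ¬∣-* {p} {m} {n} pp p∤m p∤n p∣mn with euclidsLemma m n pp p∣mn
  ... | inj₁ p∣m = p∤m p∣m
  ... | inj₂ p∣n = p∤n p∣n

  prime∣cofactor : ∀ {p q} → Prime p → Prime q → q ≢ p → ∀ v m → q ∣ p ^ v * m → q ∣ m
  prime∣cofactor {q = q} pp pq q≢p zero m q∣m = subst (q ∣_) (*-identityˡ m) q∣m
  prime∣cofactor {p} {q} pp pq q≢p (suc v) m q∣ppvm
    with euclidsLemma p (p ^ v * m) pq (subst (q ∣_) (*-assoc p (p ^ v) m) q∣ppvm)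
  ... | inj₂ q∣pvm = prime∣cofactor pp pq q≢p v m q∣pvm
  ... | inj₁ q∣p with prime⇒irreducible pp q∣p
  ...   | inj₁ q≡1 = ⊥-elim (<⇒≢ (prime≥2 pq) (sym q≡1))
  ...   | inj₂ q≡p = ⊥-elim (q≢p q≡p)

  prime∤power : ∀ {p q} → Prime p → Prime q → q ≢ p → ∀ v → ¬ q ∣ p ^ v
  prime∤power {p} {q} pp pq q≢p v q∣p^v =
    ¬prime∣1 pq (prime∣cofactor pp pq q≢p v 1 (subst (q ∣_) (sym (*-identityʳ (p ^ v))) q∣p^v))

  prime-factor : ∀ n → 2 ≤ n → ∃ λ p → Prime p × p ∣ n
  prime-factor n@(suc (suc _)) (s≤s (s≤s _)) with factorise n
  ... | record { factors = q ∷ qs ; isFactorisation = n≡q*qs ; factorsPrime = pq ∷ _ } =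
    q , pq , divides (product qs) (trans n≡q*qs (*-comm q (product qs)))
    where open import Data.Nat.ListAction using (product)

  coprime-to-power : ∀ {p m} → Prime p → ¬ p ∣ m → ∀ v → Coprime (p ^ v) m
  coprime-to-power pp p∤m zero (d∣1 , _) = ∣1⇒≡1 d∣1
  coprime-to-power {p} {m} pp p∤m (suc v) {d} (d∣p^[1+v] , d∣m) =
    coprime-to-power pp p∤m v (coprime-divisor d⊥p d∣p^[1+v] , d∣m)
    where
    d⊥p : Coprime d p
    d⊥p (e∣d , e∣p) with prime⇒irreducible pp e∣p
    ... | inj₁ e≡1 = e≡1
    ... | inj₂ refl = ⊥-elim (p∤m (∣-trans e∣d d∣m))

  record Split (p x : ℕ) : Set where
    constructor split
    field
      exp   : ℕ
      cof   : ℕ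
      eq    : x ≡ p ^ exp * cof
      p∤cof : ¬ p ∣ cof
  open Split public

  split-exists : ∀ {p} → Prime p → ∀ x → 1 ≤ x → Split p x
  split-exists {p} pp = <-rec (λ x → 1 ≤ x → Split p x) step
    where
    step : ∀ x → (∀ {y} → y < x → 1 ≤ y → Split p y) → 1 ≤ x → Split p x
    step x rec 1≤x with p ∣? x
    ... | no p∤x = split 0 x (sym (*-identityˡ x)) p∤x
    ... | yes p∣x = shift (rec q<x (>-nonZero⁻¹ q {{quotient≢0 p∣x {{>-nonZero 1≤x}}}}))
      where
      q = quotient p∣x
      q<x : q < x
      q<x = quotient-< p∣x {{prime⇒nonTrivial pp}} {{>-nonZero 1≤x}}
      shift : Split p q → Split p x
      shift (split v m q≡p^v*m p∤m) = split (suc v) m x≡p^[1+v]*m p∤m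
        where
        x≡p^[1+v]*m : x ≡ p ^ suc v * m
        x≡p^[1+v]*m = begin
          x               ≡⟨ m∣n⇒n≡m*quotient p∣x ⟩
          p * q           ≡⟨ cong (p *_) q≡p^v*m ⟩
          p * (p ^ v * m) ≡⟨ *-assoc p (p ^ v) m ⟨
          p ^ suc v * m   ∎
          where open ≡-Reasoning

  split-unique : ∀ {p} → Prime p → ∀ a b {m n} → p ^ a * m ≡ p ^ b * n → ¬ p ∣ m → ¬ p ∣ n → a ≡ b × m ≡ n
  split-unique pp zero zero {m} {n} eq _ _ = refl , trans (sym (*-identityˡ m)) (trans eq (*-identityˡ n))
  split-unique {p} pp zero (suc b) {m} {n} eq p∤m _ =
    ⊥-elim (p∤m (subst (p ∣_) (trans (sym eq) (*-identityˡ m)) (p∣p^[1+v]* p b n)))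
  split-unique {p} pp (suc a) zero {m} {n} eq _ p∤n =
    ⊥-elim (p∤n (subst (p ∣_) (trans eq (*-identityˡ n)) (p∣p^[1+v]* p a m)))
  split-unique {p} pp (suc a) (suc b) {m} {n} eq p∤m p∤n
    with split-unique pp a b (*-cancelˡ-≡ _ _ p {{prime⇒nonZero pp}} eq′) p∤m p∤n
    where
    eq′ : p * (p ^ a * m) ≡ p * (p ^ b * n)
    eq′ = trans (sym (*-assoc p (p ^ a) m)) (trans eq (*-assoc p (p ^ b) n))
  ... | a≡b , m≡n = cong suc a≡b , m≡n

  cof-positive : ∀ {p x} → 1 ≤ x → (s : Split p x) → 1 ≤ cof s
  cof-positive {p} 1≤x (split v zero eq _) with subst (1 ≤_) (trans eq (*-zeroʳ (p ^ v))) 1≤x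
  ... | ()
  cof-positive 1≤x (split _ (suc _) _ _) = s≤s z≤n

  pow-interchange : ∀ p v m w n → (p ^ v * m) * (p ^ w * n) ≡ p ^ (v + w) * (m * n)
  pow-interchange p v m w n = trans (interchange (p ^ v) m (p ^ w) n) (cong (_* (m * n)) (sym (^-distribˡ-+-* p v w)))
    where
    interchange : ∀ a m b n → (a * m) * (b * n) ≡ (a * b) * (m * n)
    interchange = solve-∀

  split-* : ∀ {p x y} → Prime p → Split p x → Split p y → Split p (x * y)
  split-* {p} pp sx sy =
    split (exp sx + exp sy) (cof sx * cof sy)
      (trans (cong₂ _*_ (eq sx) (eq sy)) (pow-interchange p (exp sx) (cof sx) (exp sy) (cof sy)))
      (¬∣-* pp (p∤cof sx) (p∤cof sy))

  coprime-exponents : ∀ {p x y} → Prime p → Coprime x y → (sx : Split p x) (sy : Split p y) → exp sx ≡ 0 ⊎ exp sy ≡ 0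
  coprime-exponents pp _ (split zero _ _ _) _ = inj₁ refl
  coprime-exponents pp _ (split (suc v) _ _ _) (split zero _ _ _) = inj₂ refl
  coprime-exponents {p} pp x⊥y (split (suc v) m refl _) (split (suc w) n refl _) =
    ⊥-elim (nonTrivial⇒≢1 {{prime⇒nonTrivial pp}} (x⊥y (p∣p^[1+v]* p v m , p∣p^[1+v]* p w n)))

  record PrimePowerFactor (n : ℕ) : Set where
    constructor factor
    field
      base    : ℕ
      expo    : ℕ
      rest    : ℕ
      isPrime : Prime base
      eq      : n ≡ base ^ suc expo * rest
      coprime : Coprime (base ^ suc expo) rest
      rest≥1  : 1 ≤ rest
      rest<n  : rest < n
      power≤n : base ^ suc expo ≤ n

  prime-power-factor : ∀ n → 2 ≤ n → PrimePowerFactor n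
  prime-power-factor n 2≤n with prime-factor n 2≤n
  ... | p , pp , p∣n with split-exists pp n (≤-trans (s≤s z≤n) 2≤n)
  ... | s@(split zero m n≡m _) = ⊥-elim (p∤cof s (subst (p ∣_) (trans n≡m (*-identityˡ m)) p∣n))
  ... | s@(split (suc v) m refl p∤m) =
    factor p v m pp refl (coprime-to-power pp p∤m (suc v)) m≥1
      (subst (m <_) (*-comm m (p ^ suc v)) (m<m*n m (p ^ suc v) {{>-nonZero m≥1}} p^[1+v]≥2))
      (m≤m*n (p ^ suc v) m {{>-nonZero m≥1}})
    where
    m≥1 = cof-positive (≤-trans (s≤s z≤n) 2≤n) s
    p^[1+v]≥2 : 2 ≤ p ^ suc v
    p^[1+v]≥2 = ≤-trans (prime≥2 pp) (base≤power (prime≥1 pp) v)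

  pow-regroup : ∀ p s d i → p ^ s * d * p ^ i ≡ p ^ (s + i) * d
  pow-regroup p s d i = trans (swap (p ^ s) d (p ^ i)) (cong (_* d) (sym (^-distribˡ-+-* p s i)))
    where
    swap : ∀ a d b → a * d * b ≡ a * b * d
    swap = solve-∀

  complementary-divisor : ∀ {p m} → Prime p → ¬ p ∣ m → ∀ d i v → 1 ≤ d →
    d * p ^ i ≡ p ^ v * m → i ≤ v × d ≡ m * p ^ (v ∸ i)
  complementary-divisor {p} {m} pp p∤m d i v 1≤d eq with split-exists pp d 1≤d
  ... | split s d′ refl p∤d′ with split-unique pp (s + i) v (trans (sym (pow-regroup p s d′ i)) eq) p∤d′ p∤m
  ...   | refl , refl = m≤n+m i s , d≡m*p^s
    where
    d≡m*p^s : p ^ s * d′ ≡ d′ * p ^ (s + i ∸ i)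
    d≡m*p^s = trans (*-comm (p ^ s) d′) (cong (λ t → d′ * p ^ t) (sym (m+n∸n≡m s i)))

  cofactor-shift : ∀ p v j m → j ≤ v → p ^ v * m ≡ m * p ^ (v ∸ j) * p ^ j
  cofactor-shift p v j m j≤v = begin
    p ^ v * m                   ≡⟨ cong (λ t → p ^ t * m) (m∸n+n≡m j≤v) ⟨
    p ^ (v ∸ j + j) * m         ≡⟨ cong (_* m) (^-distribˡ-+-* p (v ∸ j) j) ⟩
    p ^ (v ∸ j) * p ^ j * m     ≡⟨ rotate (p ^ (v ∸ j)) (p ^ j) m ⟩
    m * p ^ (v ∸ j) * p ^ j     ∎
    where
    open ≡-Reasoning
    rotate : ∀ a b m → a * b * m ≡ m * a * b
    rotate = solve-∀

  cof∣ : ∀ {p x} (s : Split p x) → cof s ∣ x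
  cof∣ {p} (split e m refl _) = n∣m*n (p ^ e)

  DivisorClosed : (ℕ → ℕ → Set) → Set
  DivisorClosed Pr = ∀ {x y m n} → Pr x y → m ∣ x → n ∣ y → Pr m n

  coprime-divisors : DivisorClosed Coprime
  coprime-divisors x⊥y m∣x n∣y (d∣m , d∣n) = x⊥y (∣-trans d∣m m∣x , ∣-trans d∣n n∣y)

  -- the trivial relation, for the completely multiplicative / additive case
  Always : ℕ → ℕ → Set
  Always _ _ = ⊤

  ExponentLaw : ∀ {ℓ} → (ℕ → ℕ → Set) → (ℕ → ℕ → ℕ → Set ℓ) → Set ℓ
  ExponentLaw Pr law = ∀ p → Prime p → ∀ {x y} → Pr x y → (sx : Split p x) (sy : Split p y) → law p (exp sx) (exp sy)

  coprime-exponent-law : ∀ {ℓ} {law : ℕ → ℕ → ℕ → Set ℓ} →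
    (∀ p → Prime p → ∀ {v w} → v ≡ 0 ⊎ w ≡ 0 → law p v w) → ExponentLaw Coprime law
  coprime-exponent-law unit p pp x⊥y sx sy = unit p pp (coprime-exponents pp x⊥y sx sy)

module Limits where
  open import Data.Nat using (_≤_; _⊔_)
  open import Data.Nat.Properties using (≤-refl; ≤-trans; m≤m⊔n; m≤n⊔m)
  open import Data.Product using (∃; _,_)

  Eventually : ∀ {p} → (ℕ → Set p) → Set p
  Eventually P = ∃ λ N₀ → ∀ N → N₀ ≤ N → P N

  eventually-≥ : ∀ M → Eventually (M ≤_)
  eventually-≥ M = M , λ _ M≤N → M≤N

  eventually-∧ : ∀ {p q} {P : ℕ → Set p} {Q : ℕ → Set q} →
    Eventually P → Eventually Q → Eventually (λ N → P N × Q N)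
  eventually-∧ (M , p) (K , q) =
    M ⊔ K , λ N le → p N (≤-trans (m≤m⊔n M K) le) , q N (≤-trans (m≤n⊔m M K) le)

  instance-of : ∀ {p} {P : ℕ → Set p} → Eventually P → ∃ P
  instance-of (N₀ , p) = N₀ , p N₀ ≤-refl

-- An exponent sequence h with h 0 = ε is a monoid homomorphism on pairs with a zero exponent:
-- this is all that coprimality forces on the factors f_p.
module UnitExponent {c ℓ} (M : Monoid c ℓ) where
  open Monoid M
  open import Data.Nat using (_+_)
  open import Data.Nat.Properties using (+-identityʳ)
  open import Data.Sum using (_⊎_; inj₁; inj₂)
  open import Relation.Binary.PropositionalEquality using (_≡_; refl; cong)

  unit-exponent : ∀ (h : ℕ → Carrier) → h 0 ≈ ε → ∀ {v w} → v ≡ 0 ⊎ w ≡ 0 → h (v + w) ≈ h v ∙ h w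
  unit-exponent h h0≈ε (inj₁ refl) = sym (trans (∙-congʳ h0≈ε) (identityˡ _))
  unit-exponent h h0≈ε {v} (inj₂ refl) =
    trans (reflexive (cong h (+-identityʳ v))) (sym (trans (∙-congˡ h0≈ε) (identityʳ _)))

module Coefficients {c ℓ} (R : CommutativeRing c ℓ) where
  open CommutativeRing R
  open Series R
  open PrimePowers
  open Limits
  open import Algebra.Definitions _≈_ using (Congruent₂)
  open import Algebra.Properties.Group +-group using (∙-cancelˡ; identityʳ-unique)
  open import Algebra.Properties.CommutativeSemigroup +-commutativeSemigroup
    using () renaming (interchange to +-interchange)
  open import Algebra.Properties.CommutativeSemigroup *-commutativeSemigroup
    using () renaming (interchange to *-interchange)
  open import Data.Nat as ℕ using (zero; suc; _≤_; _<_; z≤n; s≤s; _^_; _∸_)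
  import Data.Nat.Properties as ℕₚ
  open import Data.Nat.Divisibility using (_∣_; _∣?_; ∣⇒≤; divides)
  open import Data.Nat.DivMod using (m*n/n≡m; m*[n/m]≡n; m/n≤m; m≥n⇒m/n>0)
  open import Data.Nat.Coprimality using (Coprime; 1-coprimeTo)
  open import Data.Nat.Primality using (prime?; prime⇒nonZero)
  open import Data.Nat.Induction using (<-rec)
  open import Data.Product using (_,_; proj₁)
  open import Data.Sum using (_⊎_; inj₁; inj₂)
  open import Data.Empty using (⊥-elim)
  open import Data.Unit using (tt)
  open import Relation.Nullary using (yes; no)
  open import Relation.Binary.PropositionalEquality as ≡ using (_≡_; _≢_)
  open import Relation.Binary.Reasoning.Setoid setoid
  open UnitExponent *-monoid using () renaming (unit-exponent to *-unit-exponent)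
  open UnitExponent +-monoid using () renaming (unit-exponent to +-unit-exponent)

  sum-cong : ∀ n {g h : ℕ → Carrier} → (∀ k → k < n → g k ≈ h k) → sumBelow n g ≈ sumBelow n h
  sum-cong zero    _   = refl
  sum-cong (suc n) g≈h = +-cong (sum-cong n (λ k k<n → g≈h k (ℕₚ.m<n⇒m<1+n k<n))) (g≈h n ℕₚ.≤-refl)

  sum-zero : ∀ n {g : ℕ → Carrier} → (∀ k → k < n → g k ≈ 0#) → sumBelow n g ≈ 0#
  sum-zero zero    _   = refl
  sum-zero (suc n) g≈0 =
    trans (+-cong (sum-zero n (λ k k<n → g≈0 k (ℕₚ.m<n⇒m<1+n k<n))) (g≈0 n ℕₚ.≤-refl)) (+-identityʳ 0#)

  sum-+ : ∀ n (g h : ℕ → Carrier) → sumBelow n (λ k → g k + h k) ≈ sumBelow n g + sumBelow n h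
  sum-+ zero    g h = sym (+-identityʳ 0#)
  sum-+ (suc n) g h = trans (+-congʳ (sum-+ n g h)) (+-interchange _ _ _ _)

  erase : ℕ → (ℕ → Carrier) → ℕ → Carrier
  erase i h k with k ℕ.≟ i
  ... | yes _ = 0#
  ... | no  _ = h k

  erase-at : ∀ i h → erase i h i ≈ 0#
  erase-at i h with i ℕ.≟ i
  ... | yes _   = refl
  ... | no  i≢i = ⊥-elim (i≢i ≡.refl)

  erase-off : ∀ i h {k} → k ≢ i → erase i h k ≈ h k
  erase-off i h {k} k≢i with k ℕ.≟ i
  ... | yes k≡i = ⊥-elim (k≢i k≡i)
  ... | no  _   = refl

  sum-erase : ∀ n i h → i < n → sumBelow n h ≈ sumBelow n (erase i h) + h i
  sum-erase (suc n) i h i<1+n with ℕₚ.m<1+n⇒m<n∨m≡n i<1+n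
  ... | inj₂ ≡.refl = begin
    sumBelow n h + h i                          ≈⟨ +-congʳ (sum-cong n (λ k k<n → sym (erase-off i h (ℕₚ.<⇒≢ k<n)))) ⟩
    sumBelow n (erase i h) + h i                ≈⟨ +-congʳ (sym (+-identityʳ _)) ⟩
    (sumBelow n (erase i h) + 0#) + h i          ≈⟨ +-congʳ (+-congˡ (sym (erase-at i h))) ⟩
    (sumBelow n (erase i h) + erase i h i) + h i ∎
  ... | inj₁ i<n = begin
    sumBelow n h + h n                             ≈⟨ +-congʳ (sum-erase n i h i<n) ⟩
    (sumBelow n (erase i h) + h i) + h n           ≈⟨ +-assoc _ _ _ ⟩
    sumBelow n (erase i h) + (h i + h n)           ≈⟨ +-congˡ (+-comm _ _) ⟩
    sumBelow n (erase i h) + (h n + h i)           ≈⟨ sym (+-assoc _ _ _) ⟩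
    (sumBelow n (erase i h) + h n) + h i           ≈⟨ +-congʳ (+-congˡ (sym (erase-off i h n≢i))) ⟩
    (sumBelow n (erase i h) + erase i h n) + h i   ∎
    where
    n≢i : n ≢ i
    n≢i n≡i = ℕₚ.<⇒≢ i<n (≡.sym n≡i)

  sum-single : ∀ n i h → i < n → (∀ k → k < n → k ≢ i → h k ≈ 0#) → sumBelow n h ≈ h i
  sum-single n i h i<n others≈0 = begin
    sumBelow n h                ≈⟨ sum-erase n i h i<n ⟩
    sumBelow n (erase i h) + h i ≈⟨ +-congʳ (sum-zero n erased≈0) ⟩
    0# + h i                    ≈⟨ +-identityˡ _ ⟩
    h i                         ∎
    where
    erased≈0 : ∀ k → k < n → erase i h k ≈ 0#
    erased≈0 k k<n with k ℕ.≟ i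
    ... | yes _   = refl
    ... | no  k≢i = others≈0 k k<n k≢i

  sum-reindex : ∀ n J (φ : ℕ → ℕ) (h : ℕ → Carrier) →
    (∀ j → j < J → φ j < n) →
    (∀ i j → i < J → j < J → φ i ≡ φ j → i ≡ j) →
    (∀ k → k < n → (∀ j → j < J → k ≢ φ j) → h k ≈ 0#) →
    sumBelow n h ≈ sumBelow J (λ j → h (φ j))
  sum-reindex n zero    φ h _ _ off = sum-zero n (λ k k<n → off k k<n (λ _ ()))
  sum-reindex n (suc J) φ h φ<n φ-inj off = begin
    sumBelow n h                                      ≈⟨ sum-erase n (φ J) h (φ<n J ℕₚ.≤-refl) ⟩
    sumBelow n (erase (φ J) h) + h (φ J)              ≈⟨ +-congʳ (sum-reindex n J φ (erase (φ J) h) φ<n′ φ-inj′ off′) ⟩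
    sumBelow J (λ j → erase (φ J) h (φ j)) + h (φ J)  ≈⟨ +-congʳ (sum-cong J (λ j j<J → erase-off (φ J) h (φ≢φJ j<J))) ⟩
    sumBelow J (λ j → h (φ j)) + h (φ J)              ∎
    where
    lift = ℕₚ.m<n⇒m<1+n
    φ<n′ : ∀ j → j < J → φ j < n
    φ<n′ j j<J = φ<n j (lift j<J)
    φ-inj′ : ∀ i j → i < J → j < J → φ i ≡ φ j → i ≡ j
    φ-inj′ i j i<J j<J = φ-inj i j (lift i<J) (lift j<J)
    φ≢φJ : ∀ {j} → j < J → φ j ≢ φ J
    φ≢φJ {j} j<J e = ℕₚ.<⇒≢ j<J (φ-inj j J (lift j<J) ℕₚ.≤-refl e)
    off′ : ∀ k → k < n → (∀ j → j < J → k ≢ φ j) → erase (φ J) h k ≈ 0#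
    off′ k k<n k∉φ[J] with k ℕ.≟ φ J
    ... | yes _    = refl
    ... | no  k≢φJ = off k k<n k∉φ[1+J]
      where
      k∉φ[1+J] : ∀ j → j < suc J → k ≢ φ j
      k∉φ[1+J] j j<1+J with ℕₚ.m<1+n⇒m<n∨m≡n j<1+J
      ... | inj₁ j<J    = k∉φ[J] j j<J
      ... | inj₂ ≡.refl = k≢φJ

  -- Coefficients of g(x_p) (embed) and of Dirichlet products.

  powTerm-hit : ∀ p g {n} k → p ^ k ≡ n → powTerm p g n k ≈ g k
  powTerm-hit p g {n} k p^k≡n with p ^ k ℕ.≟ n
  ... | yes _      = refl
  ... | no  p^k≢n  = ⊥-elim (p^k≢n p^k≡n)

  powTerm-miss : ∀ p g {n} k → p ^ k ≢ n → powTerm p g n k ≈ 0#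
  powTerm-miss p g {n} k p^k≢n with p ^ k ℕ.≟ n
  ... | yes p^k≡n = ⊥-elim (p^k≢n p^k≡n)
  ... | no  _     = refl

  embed-at-power : ∀ {p} → 2 ≤ p → ∀ g j → embed p g (p ^ j) ≈ g j
  embed-at-power {p} 2≤p g j = begin
    embed p g (p ^ j)     ≈⟨ sum-single _ j _ (ℕₚ.m<n⇒m<1+n (exponent<power 2≤p j)) others≈0 ⟩
    powTerm p g (p ^ j) j ≈⟨ powTerm-hit p g j ≡.refl ⟩
    g j                   ∎
    where
    others≈0 : ∀ k → k < suc (p ^ j) → k ≢ j → powTerm p g (p ^ j) k ≈ 0#
    others≈0 k _ k≢j = powTerm-miss p g k (λ p^k≡p^j → k≢j (^-injective 2≤p p^k≡p^j))

  embed-off-powers : ∀ p g {y} → (∀ i → p ^ i ≢ y) → embed p g y ≈ 0#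
  embed-off-powers p g {y} not-power = sum-zero (suc y) (λ k _ → powTerm-miss p g k (not-power k))

  -- below p the only power of p is p^0 = 1, where g(x_p) has coefficient g 0
  embed-below : ∀ p g {n} → 2 ≤ p → n < p → g 0 ≈ 0# → embed p g n ≈ 0#
  embed-below p g {n} 2≤p n<p g0≈0 = sum-zero (suc n) term≈0
    where
    term≈0 : ∀ k → k < suc n → powTerm p g n k ≈ 0#
    term≈0 k _ with p ^ k ℕ.≟ n
    ... | no  _ = refl
    ... | yes p^k≡n with k
    ...   | zero  = g0≈0
    ...   | suc k′ = ⊥-elim (ℕₚ.<⇒≱ n<p (≡.subst (p ≤_) p^k≡n (base≤power (ℕₚ.<⇒≤ 2≤p) k′)))

  dirTerm-at : ∀ a b {x k d q} → suc k ≡ d → x ≡ d ℕ.* q → dirTerm a b x k ≈ a d * b q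
  dirTerm-at a b {k = k} {q = q} ≡.refl ≡.refl with suc k ∣? (suc k ℕ.* q)
  ... | yes _ = *-congˡ (reflexive (≡.cong b (≡.trans (≡.cong (ℕ._/ suc k) (ℕₚ.*-comm (suc k) q)) (m*n/n≡m q (suc k)))))
  ... | no  ∤ = ⊥-elim (∤ (divides q (ℕₚ.*-comm (suc k) q)))

  dirTerm-vanish : ∀ a b {x} k → (∀ q → x ≡ suc k ℕ.* q → a (suc k) * b q ≈ 0#) → dirTerm a b x k ≈ 0#
  dirTerm-vanish a b {x} k vanish with suc k ∣? x
  ... | yes k+1∣x = vanish (x ℕ./ suc k) (≡.sym (m*[n/m]≡n k+1∣x))
  ... | no  _     = refl

  -- The coefficient of b · g(x_p) at y = p^v·m (p ∤ m) runs over the divisors m·p^(v∸j) of y,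
  -- whose cofactors p^j are the only places where g(x_p) is nonzero.
  ⋆-embed : ∀ {p y} → Prime p → 1 ≤ y → (s : Split p y) → ∀ b g →
    (b ⋆ embed p g) y ≈ sumBelow (suc (exp s)) (λ j → b (cof s ℕ.* p ^ (exp s ∸ j)) * g j)
  ⋆-embed {p} pp y≥1 s@(split v m ≡.refl p∤m) b g =
    trans (sum-reindex (p ^ v ℕ.* m) (suc v) index _ index<y index-injective off-index)
          (sum-cong (suc v) at-index)
    where
    2≤p = prime≥2 pp
    m≥1 = cof-positive y≥1 s
    divisor : ℕ → ℕ
    divisor j = m ℕ.* p ^ (v ∸ j)
    index : ℕ → ℕ
    index j = ℕ.pred (divisor j)
    suc-index : ∀ j → suc (index j) ≡ divisor j
    suc-index j = ℕₚ.suc-pred (divisor j) {{ℕ.>-nonZero (*-power-positive (ℕₚ.<⇒≤ 2≤p) m≥1 (v ∸ j))}}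
    index<y : ∀ j → j < suc v → index j < p ^ v ℕ.* m
    index<y j _ = ≡.subst (_≤ p ^ v ℕ.* m) (≡.sym (suc-index j))
      (ℕₚ.≤-trans (ℕₚ.*-monoʳ-≤ m (ℕₚ.^-monoʳ-≤ p {{prime⇒nonZero pp}} (ℕₚ.m∸n≤m v j)))
                  (ℕₚ.≤-reflexive (ℕₚ.*-comm m (p ^ v))))
    index-injective : ∀ i j → i < suc v → j < suc v → index i ≡ index j → i ≡ j
    index-injective i j (s≤s i≤v) (s≤s j≤v) same-index =
      ≡.trans (≡.sym (ℕₚ.m∸[m∸n]≡n i≤v)) (≡.trans (≡.cong (v ∸_) same-exponent) (ℕₚ.m∸[m∸n]≡n j≤v))
      where
      same-divisor : divisor i ≡ divisor j
      same-divisor = ≡.trans (≡.sym (suc-index i)) (≡.trans (≡.cong suc same-index) (suc-index j))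
      same-exponent : v ∸ i ≡ v ∸ j
      same-exponent = ^-injective 2≤p (ℕₚ.*-cancelˡ-≡ _ _ m {{ℕ.>-nonZero m≥1}} same-divisor)
    at-index : ∀ j → j < suc v → dirTerm b (embed p g) (p ^ v ℕ.* m) (index j) ≈ b (divisor j) * g j
    at-index j (s≤s j≤v) = trans (dirTerm-at b (embed p g) (suc-index j) (cofactor-shift p v j m j≤v))
                                 (*-congˡ (embed-at-power 2≤p g j))
    off-index : ∀ k → k < p ^ v ℕ.* m → (∀ j → j < suc v → k ≢ index j) →
      dirTerm b (embed p g) (p ^ v ℕ.* m) k ≈ 0#
    off-index k _ k∉index = dirTerm-vanish b (embed p g) k
      (λ q y≡[1+k]q → trans (*-congˡ (embed-off-powers p g (not-power q y≡[1+k]q))) (zeroʳ _))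
      where
      not-power : ∀ q → p ^ v ℕ.* m ≡ suc k ℕ.* q → ∀ i → p ^ i ≢ q
      not-power q y≡[1+k]q i p^i≡q
        with complementary-divisor pp p∤m (suc k) i v (s≤s z≤n)
               (≡.sym (≡.trans y≡[1+k]q (≡.cong (suc k ℕ.*_) (≡.sym p^i≡q))))
      ... | i≤v , 1+k≡divisor = k∉index i (s≤s i≤v) (≡.cong ℕ.pred 1+k≡divisor)

  ⋆-embed-top : ∀ {p y} → Prime p → 1 ≤ y → (s : Split p y) → ∀ b g →
    (∀ {z} → 1 ≤ z → p ∣ z → b z ≈ 0#) → (b ⋆ embed p g) y ≈ b (cof s) * g (exp s)
  ⋆-embed-top {p} {y} pp y≥1 s b g b-vanishes = begin
    (b ⋆ embed p g) y                 ≈⟨ ⋆-embed pp y≥1 s b g ⟩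
    sumBelow v term + term v          ≈⟨ +-congʳ (sum-zero v lower≈0) ⟩
    0# + term v                       ≈⟨ +-identityˡ _ ⟩
    b (m ℕ.* p ^ (v ∸ v)) * g v       ≈⟨ *-congʳ (reflexive (≡.cong b m*p^[v∸v]≡m)) ⟩
    b m * g v                         ∎
    where
    v = exp s
    m = cof s
    term : ℕ → Carrier
    term j = b (m ℕ.* p ^ (v ∸ j)) * g j
    lower≈0 : ∀ j → j < v → term j ≈ 0#
    lower≈0 j j<v = trans (*-congʳ (b-vanishes (*-power-positive (prime≥1 pp) (cof-positive y≥1 s) (v ∸ j))
                                               (p∣*p^[v∸j] p m j<v)))
                          (zeroˡ _)
    m*p^[v∸v]≡m : m ℕ.* p ^ (v ∸ v) ≡ m
    m*p^[v∸v]≡m = ≡.trans (≡.cong (λ t → m ℕ.* p ^ t) (ℕₚ.n∸n≡0 v)) (ℕₚ.*-identityʳ m)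

  -- Partial products Π_{p<N} f_p(x_p).

  δ-off : ∀ {y} → y ≢ 1 → δ y ≈ 0#
  δ-off {y} y≢1 with y ℕ.≟ 1
  ... | yes y≡1 = ⊥-elim (y≢1 y≡1)
  ... | no  _   = refl

  δ-multiplicative : ∀ x y → δ (x ℕ.* y) ≈ δ x * δ y
  δ-multiplicative x y with x ℕ.≟ 1 | y ℕ.≟ 1
  ... | yes ≡.refl | yes ≡.refl = sym (*-identityˡ 1#)
  ... | yes ≡.refl | no y≢1 = trans (δ-off (λ 1*y≡1 → y≢1 (≡.trans (≡.sym (ℕₚ.*-identityˡ y)) 1*y≡1)))
                                    (sym (zeroʳ 1#))
  ... | no x≢1 | _ = trans (δ-off (λ xy≡1 → x≢1 (ℕₚ.m*n≡1⇒m≡1 x y xy≡1)))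
                           (sym (zeroˡ _))

  partialProd-vanishes : ∀ f N {y q} → 1 ≤ y → Prime q → N ≤ q → q ∣ y → partialProd f N y ≈ 0#
  partialProd-vanishes f zero {y} {q} _ pq _ q∣y = δ-off (λ y≡1 → ¬prime∣1 pq (≡.subst (q ∣_) y≡1 q∣y))
  partialProd-vanishes f (suc N) {y} {q} y≥1 pq N<q q∣y with prime? N
  ... | no _   = partialProd-vanishes f N y≥1 pq (ℕₚ.<⇒≤ N<q) q∣y
  ... | yes pN = begin
    (partialProd f N ⋆ embed N (f N)) y ≈⟨ ⋆-embed-top pN y≥1 s (partialProd f N) (f N)
                                             (λ z≥1 → partialProd-vanishes f N z≥1 pN ℕₚ.≤-refl) ⟩
    partialProd f N (cof s) * f N (exp s) ≈⟨ *-congʳ (partialProd-vanishes f N (cof-positive y≥1 s) pq (ℕₚ.<⇒≤ N<q) q∣cof) ⟩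
    0# * f N (exp s)                      ≈⟨ zeroˡ _ ⟩
    0#                                    ∎
    where
    s = split-exists pN y y≥1
    q∣cof : q ∣ cof s
    q∣cof = prime∣cofactor pN pq (λ q≡N → ℕₚ.<⇒≢ N<q (≡.sym q≡N)) (exp s) (cof s) (≡.subst (q ∣_) (eq s) q∣y)

  partialProd-adjoin : ∀ f {p y} → Prime p → 1 ≤ y → (s : Split p y) →
    (partialProd f p ⋆ embed p (f p)) y ≈ partialProd f p (cof s) * f p (exp s)
  partialProd-adjoin f {p} pp y≥1 s =
    ⋆-embed-top pp y≥1 s (partialProd f p) (f p) (λ z≥1 → partialProd-vanishes f p z≥1 pp ℕₚ.≤-refl)

  partialProd-one : ∀ f → (∀ p → Prime p → f p 0 ≈ 1#) → ∀ N → partialProd f N 1 ≈ 1#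
  partialProd-one f f1 zero = refl
  partialProd-one f f1 (suc N) with prime? N
  ... | no _   = partialProd-one f f1 N
  ... | yes pN = begin
    (partialProd f N ⋆ embed N (f N)) 1 ≈⟨ partialProd-adjoin f pN ℕₚ.≤-refl (split 0 1 ≡.refl (¬prime∣1 pN)) ⟩
    partialProd f N 1 * f N 0           ≈⟨ *-cong (partialProd-one f f1 N) (f1 N pN) ⟩
    1# * 1#                             ≈⟨ *-identityˡ 1# ⟩
    1#                                  ∎

  partialProd-prime-power : ∀ f → (∀ p → Prime p → f p 0 ≈ 1#) →
    ∀ {p} → Prime p → ∀ N → p < N → ∀ v → partialProd f N (p ^ v) ≈ f p v
  partialProd-prime-power f f1 {p} pp (suc N) p<1+N v with ℕₚ.m<1+n⇒m<n∨m≡n p<1+N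
  ... | inj₂ ≡.refl with prime? p
  ...   | no ¬pp = ⊥-elim (¬pp pp)
  ...   | yes _  = begin
    (partialProd f p ⋆ embed p (f p)) (p ^ v) ≈⟨ partialProd-adjoin f pp (^-positive 1≤p v)
                                                   (split v 1 (≡.sym (ℕₚ.*-identityʳ (p ^ v))) (¬prime∣1 pp)) ⟩
    partialProd f p 1 * f p v                 ≈⟨ *-congʳ (partialProd-one f f1 p) ⟩
    1# * f p v                                ≈⟨ *-identityˡ _ ⟩
    f p v                                     ∎
    where 1≤p = prime≥1 pp
  partialProd-prime-power f f1 {p} pp (suc N) p<1+N v | inj₁ p<N with prime? N
  ...   | no _   = partialProd-prime-power f f1 pp N p<N v
  ...   | yes pN = begin
    (partialProd f N ⋆ embed N (f N)) (p ^ v) ≈⟨ partialProd-adjoin f pN (^-positive 1≤p v)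
                                                   (split 0 (p ^ v) (≡.sym (ℕₚ.*-identityˡ (p ^ v)))
                                                     (prime∤power pp pN (λ N≡p → ℕₚ.<⇒≢ p<N (≡.sym N≡p)) v)) ⟩
    partialProd f N (p ^ v) * f N 0           ≈⟨ *-cong (partialProd-prime-power f f1 pp N p<N v) (f1 N pN) ⟩
    f p v * 1#                                ≈⟨ *-identityʳ _ ⟩
    f p v                                     ∎
    where 1≤p = prime≥1 pp

  Hom : (ℕ → ℕ → Set) → (Carrier → Carrier → Carrier) → Arith → Set ℓ
  Hom Pr _∙_ a = ∀ m n → 1 ≤ m → 1 ≤ n → Pr m n → a (m ℕ.* n) ≈ a m ∙ a n

  MultiplicativeLaw : (ℕ → PS) → ℕ → ℕ → ℕ → Set ℓ
  MultiplicativeLaw f p v w = f p (v ℕ.+ w) ≈ f p v * f p w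

  partialProd-hom : ∀ f Pr → DivisorClosed Pr → ExponentLaw Pr (MultiplicativeLaw f) →
    ∀ N → Hom Pr _*_ (partialProd f N)
  partialProd-hom f Pr closed law zero x y _ _ _ = δ-multiplicative x y
  partialProd-hom f Pr closed law (suc N) x y x≥1 y≥1 r with prime? N
  ... | no _   = partialProd-hom f Pr closed law N x y x≥1 y≥1 r
  ... | yes pN = begin
    P (x ℕ.* y)                       ≈⟨ partialProd-adjoin f pN (ℕₚ.*-mono-≤ x≥1 y≥1) (split-* pN sx sy) ⟩
    Q (m ℕ.* n) * f N (v ℕ.+ w)        ≈⟨ *-cong (partialProd-hom f Pr closed law N m n m≥1 n≥1 (closed r (cof∣ sx) (cof∣ sy)))
                                                 (law N pN r sx sy) ⟩
    (Q m * Q n) * (f N v * f N w)      ≈⟨ *-interchange _ _ _ _ ⟩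
    (Q m * f N v) * (Q n * f N w)      ≈⟨ sym (*-cong (partialProd-adjoin f pN x≥1 sx) (partialProd-adjoin f pN y≥1 sy)) ⟩
    P x * P y                          ∎
    where
    P = partialProd f N ⋆ embed N (f N)
    Q = partialProd f N
    sx = split-exists pN x x≥1
    sy = split-exists pN y y≥1
    v = exp sx
    w = exp sy
    m = cof sx
    n = cof sy
    m≥1 = cof-positive x≥1 sx
    n≥1 = cof-positive y≥1 sy

  -- Partial sums, multiplied by u.

  -- the coefficients of g(x)/(1 - x), i.e. of u(x_p)·g(x_p) at the powers of p
  cumulative : PS → PS
  cumulative g v = sumBelow (suc v) g

  uSum : (ℕ → PS) → ℕ → Arith
  uSum f N = u ⋆ partialSum f N

  u⋆-cong : ∀ A B n → (∀ d → 1 ≤ d → d ≤ n → A d ≈ B d) → (u ⋆ A) n ≈ (u ⋆ B) n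
  u⋆-cong A B zero    _   = refl
  u⋆-cong A B n@(suc _) A≈B = sum-cong n term≈
    where
    term≈ : ∀ k → k < n → dirTerm u A n k ≈ dirTerm u B n k
    term≈ k _ with suc k ∣? n
    ... | yes k+1∣n = *-congˡ (A≈B (n ℕ./ suc k) (m≥n⇒m/n>0 (∣⇒≤ k+1∣n)) (m/n≤m n (suc k)))
    ... | no  _     = refl

  u⋆-⊕ : ∀ A B n → (u ⋆ (A ⊕ B)) n ≈ (u ⋆ A) n + (u ⋆ B) n
  u⋆-⊕ A B n = trans (sum-cong n term-⊕) (sum-+ n _ _)
    where
    term-⊕ : ∀ k → k < n → dirTerm u (A ⊕ B) n k ≈ dirTerm u A n k + dirTerm u B n k
    term-⊕ k _ with suc k ∣? n
    ... | yes _ = distribˡ _ _ _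
    ... | no  _ = sym (+-identityʳ 0#)

  u⋆-𝟘 : ∀ n → (u ⋆ 𝟘) n ≈ 0#
  u⋆-𝟘 n = sum-zero n (λ k _ → dirTerm-vanish u 𝟘 {n} k (λ _ _ → zeroʳ _))

  u⋆embed : ∀ {p y} → Prime p → 1 ≤ y → (s : Split p y) → ∀ g → (u ⋆ embed p g) y ≈ cumulative g (exp s)
  u⋆embed pp y≥1 s g = trans (⋆-embed pp y≥1 s u g) (sum-cong (suc (exp s)) (λ j _ → *-identityˡ (g j)))

  u⋆embed-other : ∀ {p q} → Prime p → Prime q → q ≢ p → ∀ g → g 0 ≈ 0# → ∀ v → (u ⋆ embed q g) (p ^ v) ≈ 0#
  u⋆embed-other {p} pp pq q≢p g g0≈0 v =
    trans (u⋆embed pq (^-positive (prime≥1 pp) v)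
                   (split 0 (p ^ v) (≡.sym (ℕₚ.*-identityˡ (p ^ v))) (prime∤power pp pq q≢p v)) g)
          (trans (+-identityˡ _) g0≈0)

  AdditiveLaw : (ℕ → PS) → ℕ → ℕ → ℕ → Set ℓ
  AdditiveLaw f p v w = cumulative (f p) (v ℕ.+ w) ≈ cumulative (f p) v + cumulative (f p) w

  uSum-hom : ∀ f Pr → ExponentLaw Pr (AdditiveLaw f) → ∀ N → Hom Pr _+_ (uSum f N)
  uSum-hom f Pr law zero x y _ _ _ =
    trans (u⋆-𝟘 (x ℕ.* y)) (sym (trans (+-cong (u⋆-𝟘 x) (u⋆-𝟘 y)) (+-identityʳ 0#)))
  uSum-hom f Pr law (suc N) x y x≥1 y≥1 r with prime? N
  ... | no _   = uSum-hom f Pr law N x y x≥1 y≥1 r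
  ... | yes pN = begin
    (u ⋆ (partialSum f N ⊕ e)) (x ℕ.* y) ≈⟨ u⋆-⊕ (partialSum f N) e (x ℕ.* y) ⟩
    T (x ℕ.* y) + E (x ℕ.* y)            ≈⟨ +-cong (uSum-hom f Pr law N x y x≥1 y≥1 r) E-additive ⟩
    (T x + T y) + (E x + E y)            ≈⟨ +-interchange _ _ _ _ ⟩
    (T x + E x) + (T y + E y)            ≈⟨ sym (+-cong (u⋆-⊕ _ _ x) (u⋆-⊕ _ _ y)) ⟩
    (u ⋆ (partialSum f N ⊕ e)) x + (u ⋆ (partialSum f N ⊕ e)) y ∎
    where
    e = embed N (f N)
    T = uSum f N
    E = u ⋆ e
    sx = split-exists pN x x≥1
    sy = split-exists pN y y≥1
    E-additive : E (x ℕ.* y) ≈ E x + E y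
    E-additive = begin
      E (x ℕ.* y)                                     ≈⟨ u⋆embed pN (ℕₚ.*-mono-≤ x≥1 y≥1) (split-* pN sx sy) (f N) ⟩
      cumulative (f N) (exp sx ℕ.+ exp sy)             ≈⟨ law N pN r sx sy ⟩
      cumulative (f N) (exp sx) + cumulative (f N) (exp sy) ≈⟨ sym (+-cong (u⋆embed pN x≥1 sx (f N)) (u⋆embed pN y≥1 sy (f N))) ⟩
      E x + E y                                       ∎

  uSum-before : ∀ f → (∀ q → Prime q → f q 0 ≈ 0#) → ∀ {p} → Prime p → ∀ N → N ≤ p → ∀ v →
    uSum f N (p ^ v) ≈ 0#
  uSum-before f f0 {p} pp zero _ v = u⋆-𝟘 (p ^ v)
  uSum-before f f0 {p} pp (suc N) N<p v with prime? N
  ... | no _   = uSum-before f f0 pp N (ℕₚ.<⇒≤ N<p) v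
  ... | yes pN = trans (u⋆-⊕ (partialSum f N) (embed N (f N)) (p ^ v))
    (trans (+-cong (uSum-before f f0 pp N (ℕₚ.<⇒≤ N<p) v) (u⋆embed-other pp pN (ℕₚ.<⇒≢ N<p) (f N) (f0 N pN) v))
           (+-identityʳ 0#))

  uSum-prime-power : ∀ f → (∀ q → Prime q → f q 0 ≈ 0#) → ∀ {p} → Prime p → ∀ N → p < N → ∀ v →
    uSum f N (p ^ v) ≈ cumulative (f p) v
  uSum-prime-power f f0 {p} pp (suc N) p<1+N v with ℕₚ.m<1+n⇒m<n∨m≡n p<1+N
  ... | inj₂ ≡.refl with prime? p
  ...   | no ¬pp = ⊥-elim (¬pp pp)
  ...   | yes _  = trans (u⋆-⊕ (partialSum f p) (embed p (f p)) (p ^ v))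
    (trans (+-cong (uSum-before f f0 pp p ℕₚ.≤-refl v)
                   (u⋆embed pp (^-positive (prime≥1 pp) v)
                            (split v 1 (≡.sym (ℕₚ.*-identityʳ (p ^ v))) (¬prime∣1 pp)) (f p)))
           (+-identityˡ _))
  uSum-prime-power f f0 {p} pp (suc N) p<1+N v | inj₁ p<N with prime? N
  ...   | no _   = uSum-prime-power f f0 pp N p<N v
  ...   | yes pN = trans (u⋆-⊕ (partialSum f N) (embed N (f N)) (p ^ v))
    (trans (+-cong (uSum-prime-power f f0 pp N p<N v)
                   (u⋆embed-other pp pN (λ N≡p → ℕₚ.<⇒≢ p<N (≡.sym N≡p)) (f N) (f0 N pN) v))
           (+-identityʳ _))

  -- the coefficient at n of the partial sums is constant for N > n: primes p > n add f_p(0) = 0 there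
  partialSum-stable : ∀ f → (∀ q → Prime q → f q 0 ≈ 0#) → ∀ n N → n < N → partialSum f N n ≈ partialSum f (suc n) n
  partialSum-stable f f0 n (suc N) (s≤s n≤N) with ℕₚ.m≤n⇒m<n∨m≡n n≤N
  ... | inj₂ ≡.refl = refl
  ... | inj₁ n<N with prime? N
  ...   | no _   = partialSum-stable f f0 n N n<N
  ...   | yes pN = trans (+-cong (partialSum-stable f f0 n N n<N) (embed-below N (f N) (prime≥2 pN) n<N (f0 N pN)))
                         (+-identityʳ _)

  converges-below : ∀ {s : ℕ → Arith} {L} → ConvergesTo s L → ∀ x →
    Eventually (λ N → ∀ d → 1 ≤ d → d ≤ x → s N d ≈ L d)
  converges-below cv zero = 0 , λ _ _ d d≥1 d≤0 → ⊥-elim (ℕₚ.<⇒≱ d≥1 d≤0)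
  converges-below {s} {L} cv (suc x) with eventually-∧ (converges-below cv x) (cv (suc x) (s≤s z≤n))
  ... | N₀ , below&at = N₀ , λ N N₀≤N d d≥1 d≤1+x → up-to (below&at N N₀≤N) d d≥1 (ℕₚ.m≤n⇒m<n∨m≡n d≤1+x)
    where
    up-to : ∀ {N} → (∀ d → 1 ≤ d → d ≤ x → s N d ≈ L d) × s N (suc x) ≈ L (suc x) →
            ∀ d → 1 ≤ d → d < suc x ⊎ d ≡ suc x → s N d ≈ L d
    up-to (below , at) d d≥1 (inj₁ d<1+x) = below d d≥1 (ℕₚ.≤-pred d<1+x)
    up-to (below , at) d d≥1 (inj₂ ≡.refl) = at

  uSum-converges : ∀ f a → IsUTimesSum f a → ∀ x → 1 ≤ x → Eventually (λ N → uSum f N x ≈ a x)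
  uSum-converges f a (S , cv , a≋uS) x x≥1 with converges-below cv x
  ... | N₀ , close = N₀ , λ N N₀≤N →
    trans (u⋆-cong _ _ x (close N N₀≤N)) (sym (a≋uS x x≥1))

  hom-limit : ∀ {Pr _∙_} → Congruent₂ _∙_ → ∀ {s : ℕ → Arith} {a} →
    (∀ x → 1 ≤ x → Eventually (λ N → s N x ≈ a x)) → (∀ N → Hom Pr _∙_ (s N)) → Hom Pr _∙_ a
  hom-limit {_∙_ = _∙_} ∙-cong {s} {a} lim hom x y x≥1 y≥1 r
    with instance-of (eventually-∧ (lim x x≥1) (eventually-∧ (lim y y≥1) (lim (x ℕ.* y) (ℕₚ.*-mono-≤ x≥1 y≥1))))
  ... | N , sx≈ax , sy≈ay , sxy≈axy = begin
    a (x ℕ.* y)    ≈⟨ sym sxy≈axy ⟩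
    s N (x ℕ.* y)  ≈⟨ hom N x y x≥1 y≥1 r ⟩
    s N x ∙ s N y  ≈⟨ ∙-cong sx≈ax sy≈ay ⟩
    a x ∙ a y      ∎

  -- Two coprime-homomorphisms that agree at 1 and at the prime powers up to n agree at n
  -- (strong induction: split off one prime-power factor of n).
  hom-determined : ∀ {_∙_} → Congruent₂ _∙_ → ∀ {A B} → Hom Coprime _∙_ A → Hom Coprime _∙_ B → A 1 ≈ B 1 →
    ∀ n → 1 ≤ n → (∀ p k → Prime p → p ^ suc k ≤ n → A (p ^ suc k) ≈ B (p ^ suc k)) → A n ≈ B n
  hom-determined {_∙_} ∙-cong {A} {B} homA homB A1≈B1 = <-rec Goal step
    where
    Goal : ℕ → Set ℓ
    Goal n = 1 ≤ n → (∀ p k → Prime p → p ^ suc k ≤ n → A (p ^ suc k) ≈ B (p ^ suc k)) → A n ≈ B n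
    step : ∀ n → (∀ {m} → m < n → Goal m) → Goal n
    step n rec n≥1 agree with ℕₚ.m≤n⇒m<n∨m≡n n≥1
    ... | inj₂ ≡.refl = A1≈B1
    ... | inj₁ 1<n with prime-power-factor n 1<n
    ...   | factor p v m pp ≡.refl q⊥m m≥1 m<n q≤n = begin
      A (q ℕ.* m)  ≈⟨ homA q m q≥1 m≥1 q⊥m ⟩
      A q ∙ A m    ≈⟨ ∙-cong (agree p v pp q≤n) (rec m<n m≥1 agree-below-m) ⟩
      B q ∙ B m    ≈⟨ sym (homB q m q≥1 m≥1 q⊥m) ⟩
      B (q ℕ.* m)  ∎
      where
      q = p ^ suc v
      q≥1 = ^-positive (prime≥1 pp) (suc v)
      agree-below-m : ∀ p′ k → Prime p′ → p′ ^ suc k ≤ m → A (p′ ^ suc k) ≈ B (p′ ^ suc k)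
      agree-below-m p′ k pp′ ≤m = agree p′ k pp′ (ℕₚ.≤-trans ≤m (ℕₚ.<⇒≤ m<n))

  coprime-multiplicative-law : ∀ f → (∀ p → Prime p → f p 0 ≈ 1#) → ExponentLaw Coprime (MultiplicativeLaw f)
  coprime-multiplicative-law f f1 = coprime-exponent-law (λ p pp → *-unit-exponent (f p) (f1 p pp))

  coprime-additive-law : ∀ f → (∀ p → Prime p → f p 0 ≈ 0#) → ExponentLaw Coprime (AdditiveLaw f)
  coprime-additive-law f f0 =
    coprime-exponent-law (λ p pp → +-unit-exponent (cumulative (f p)) (trans (+-identityˡ _) (f0 p pp)))

  pow-+ : ∀ x v w → pow x (v ℕ.+ w) ≈ pow x v * pow x w
  pow-+ x zero    w = sym (*-identityˡ _)
  pow-+ x (suc v) w = trans (*-congˡ (pow-+ x v w)) (sym (*-assoc _ _ _))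

  cumulative-linear : ∀ x v w →
    cumulative (cxOver1-x x) (v ℕ.+ w) ≈ cumulative (cxOver1-x x) v + cumulative (cxOver1-x x) w
  cumulative-linear x v zero = trans (reflexive (≡.cong (cumulative (cxOver1-x x)) (ℕₚ.+-identityʳ v)))
                                     (sym (trans (+-congˡ (+-identityˡ 0#)) (+-identityʳ _)))
  cumulative-linear x v (suc w) = begin
    cumulative (cxOver1-x x) (v ℕ.+ suc w)
      ≈⟨ reflexive (≡.cong (cumulative (cxOver1-x x)) (ℕₚ.+-suc v w)) ⟩
    cumulative (cxOver1-x x) (v ℕ.+ w) + x                            ≈⟨ +-congʳ (cumulative-linear x v w) ⟩
    (cumulative (cxOver1-x x) v + cumulative (cxOver1-x x) w) + x      ≈⟨ +-assoc _ _ _ ⟩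
    cumulative (cxOver1-x x) v + cumulative (cxOver1-x x) (suc w)      ∎

  additive-at-one : ∀ {a} → Hom Coprime _+_ a → a 1 ≈ 0#
  additive-at-one {a} hom = identityʳ-unique (a 1) (a 1) (sym (hom 1 1 ℕₚ.≤-refl ℕₚ.≤-refl (1-coprimeTo 1)))

  increments : (ℕ → Carrier) → PS
  increments h zero    = 0#
  increments h (suc k) = h (suc k) - h k

  cumulative-increments : ∀ h → h 0 ≈ 0# → ∀ k → cumulative (increments h) k ≈ h k
  cumulative-increments h h0≈0 zero    = trans (+-identityˡ 0#) (sym h0≈0)
  cumulative-increments h h0≈0 (suc k) = begin
    cumulative (increments h) k + (h (suc k) - h k) ≈⟨ +-congʳ (cumulative-increments h h0≈0 k) ⟩
    h k + (h (suc k) - h k)                         ≈⟨ +-congˡ (+-comm _ _) ⟩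
    h k + (- h k + h (suc k))                       ≈⟨ sym (+-assoc _ _ _) ⟩
    (h k - h k) + h (suc k)                         ≈⟨ +-congʳ (-‿inverseʳ _) ⟩
    0# + h (suc k)                                  ≈⟨ +-identityˡ _ ⟩
    h (suc k)                                       ∎

  completely-multiplicative-powers : ∀ {a} → CompletelyMultiplicative a → ∀ {p} → 1 ≤ p → ∀ k → pow (a p) k ≈ a (p ^ k)
  completely-multiplicative-powers (a1≈1 , _)      _   zero    = sym a1≈1
  completely-multiplicative-powers (a1≈1 , a-mult) 1≤p (suc k) =
    trans (*-congˡ (completely-multiplicative-powers (a1≈1 , a-mult) 1≤p k)) (sym (a-mult _ _ 1≤p (^-positive 1≤p k)))

  completely-additive-powers : ∀ {a} → CompletelyAdditive a → ∀ {p} → 1 ≤ p → ∀ k →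
    cumulative (cxOver1-x (a p)) k ≈ a (p ^ k)
  completely-additive-powers a-add _ zero =
    trans (+-identityˡ 0#) (sym (additive-at-one (λ m n hm hn _ → a-add m n hm hn)))
  completely-additive-powers a-add 1≤p (suc k) =
    trans (+-congʳ (completely-additive-powers a-add 1≤p k)) (trans (+-comm _ _) (sym (a-add _ _ 1≤p (^-positive 1≤p k))))

  -- Part (1): multiplicative functions are the infinite products Π_p f_p(x_p).

  product-at-one : ∀ {f a} → (∀ p → Prime p → f p 0 ≈ 1#) → IsInfProd f a → a 1 ≈ 1#
  product-at-one {f} f1 cv with instance-of (cv 1 ℕₚ.≤-refl)
  ... | N , QN1≈a1 = trans (sym QN1≈a1) (partialProd-one f f1 N)

  product-hom : ∀ {f a} Pr → DivisorClosed Pr → ExponentLaw Pr (MultiplicativeLaw f) → IsInfProd f a → Hom Pr _*_ a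
  product-hom {f} Pr closed law cv = hom-limit *-cong cv (partialProd-hom f Pr closed law)

  multiplicative⇒product : ∀ {f a} → Multiplicative a → (∀ p → Prime p → f p 0 ≈ 1#) →
    (∀ p k → Prime p → f p (suc k) ≈ a (p ^ suc k)) → IsInfProd f a
  multiplicative⇒product {f} {a} (a1≈1 , a-mult) f1 f≈a n n≥1 = suc n , λ N n<N →
    hom-determined *-cong (partialProd-hom f Coprime coprime-divisors (coprime-multiplicative-law f f1) N) a-mult
      (trans (partialProd-one f f1 N) (sym a1≈1)) n n≥1
      (λ p k pp ≤n → trans (partialProd-prime-power f f1 pp N (ℕₚ.≤-<-trans (prime≤ pp k ≤n) n<N) (suc k))
                           (f≈a p k pp))

  multiplicative⇔product : ∀ a → Multiplicative a ⟺ (Σ (ℕ → PS) λ f → (∀ p → Prime p → f p 0 ≈ 1#) × IsInfProd f a)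
  multiplicative⇔product a = to , from
    where
    to : Multiplicative a → Σ (ℕ → PS) λ f → (∀ p → Prime p → f p 0 ≈ 1#) × IsInfProd f a
    to a-mult = (λ p k → a (p ^ k)) , (λ _ _ → proj₁ a-mult) ,
                multiplicative⇒product a-mult (λ _ _ → proj₁ a-mult) (λ _ _ _ → refl)
    from : (Σ (ℕ → PS) λ f → (∀ p → Prime p → f p 0 ≈ 1#) × IsInfProd f a) → Multiplicative a
    from (f , f1 , cv) = product-at-one f1 cv , product-hom Coprime coprime-divisors (coprime-multiplicative-law f f1) cv

  -- the factors are the restrictions of a to the powers of each prime, hence unique
  product-unique : ∀ a f g →
    (∀ p → Prime p → f p 0 ≈ 1#) → IsInfProd f a → (∀ p → Prime p → g p 0 ≈ 1#) → IsInfProd g a →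
    ∀ p → Prime p → ∀ k → f p k ≈ g p k
  product-unique a f g f1 cf g1 cg p pp k
    with instance-of (eventually-∧ (eventually-≥ (suc p)) (eventually-∧ (cf (p ^ k) p^k≥1) (cg (p ^ k) p^k≥1)))
    where p^k≥1 = ^-positive (prime≥1 pp) k
  ... | N , p<N , f→a , g→a = begin
    f p k                   ≈⟨ sym (partialProd-prime-power f f1 pp N p<N k) ⟩
    partialProd f N (p ^ k) ≈⟨ f→a ⟩
    a (p ^ k)               ≈⟨ sym g→a ⟩
    partialProd g N (p ^ k) ≈⟨ partialProd-prime-power g g1 pp N p<N k ⟩
    g p k                   ∎

  completelyMultiplicative⇔geometric : ∀ a → CompletelyMultiplicative a ⟺
    (Σ (ℕ → Carrier) λ cs → IsInfProd (λ p → geomPS (cs p)) a)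
  completelyMultiplicative⇔geometric a = to , from
    where
    to : CompletelyMultiplicative a → Σ (ℕ → Carrier) λ cs → IsInfProd (λ p → geomPS (cs p)) a
    to a-cmult@(a1≈1 , a-mult) = a , multiplicative⇒product (a1≈1 , λ m n hm hn _ → a-mult m n hm hn) (λ _ _ → refl)
      (λ p k pp → completely-multiplicative-powers a-cmult (prime≥1 pp) (suc k))
    from : (Σ (ℕ → Carrier) λ cs → IsInfProd (λ p → geomPS (cs p)) a) → CompletelyMultiplicative a
    from (cs , cv) = product-at-one (λ _ _ → refl) cv , λ m n hm hn →
      product-hom Always (λ _ _ _ → tt) (λ p _ _ sx sy → pow-+ (cs p) (exp sx) (exp sy)) cv m n hm hn tt

  -- Part (2): additive functions are u · Σ_p f_p(x_p).

  sum-hom : ∀ {f a} Pr → ExponentLaw Pr (AdditiveLaw f) → IsUTimesSum f a → Hom Pr _+_ a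
  sum-hom {f} {a} Pr law is = hom-limit +-cong (uSum-converges f a is) (uSum-hom f Pr law)

  additive⇒uSum : ∀ {f a} → Additive a → (∀ p → Prime p → f p 0 ≈ 0#) →
    (∀ p k → Prime p → cumulative (f p) (suc k) ≈ a (p ^ suc k)) → IsUTimesSum f a
  additive⇒uSum {f} {a} a-add f0 f≈a = L , L-limit , a≋uL
    where
    L : Arith
    L n = partialSum f (suc n) n
    L-limit : ConvergesTo (partialSum f) L
    L-limit n _ = suc n , partialSum-stable f f0 n
    uSum-add : ∀ N → Hom Coprime _+_ (uSum f N)
    uSum-add = uSum-hom f Coprime (coprime-additive-law f f0)
    a≋uL : a ≋ (u ⋆ L)
    a≋uL n n≥1 = begin
      a n               ≈⟨ sym (hom-determined +-cong (uSum-add (suc n)) a-add at-one n n≥1 at-prime-powers) ⟩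
      uSum f (suc n) n  ≈⟨ u⋆-cong _ _ n (λ d _ d≤n → partialSum-stable f f0 d (suc n) (s≤s d≤n)) ⟩
      (u ⋆ L) n         ∎
      where
      at-one : uSum f (suc n) 1 ≈ a 1
      at-one = trans (additive-at-one (uSum-add (suc n))) (sym (additive-at-one a-add))
      at-prime-powers : ∀ p k → Prime p → p ^ suc k ≤ n → uSum f (suc n) (p ^ suc k) ≈ a (p ^ suc k)
      at-prime-powers p k pp ≤n = trans (uSum-prime-power f f0 pp (suc n) (s≤s (prime≤ pp k ≤n)) (suc k)) (f≈a p k pp)

  additive⇔uSum : ∀ a → Additive a ⟺ (Σ (ℕ → PS) λ f → (∀ p → Prime p → f p 0 ≈ 0#) × IsUTimesSum f a)
  additive⇔uSum a = to , from
    where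
    to : Additive a → Σ (ℕ → PS) λ f → (∀ p → Prime p → f p 0 ≈ 0#) × IsUTimesSum f a
    to a-add = f , (λ _ _ → refl) , additive⇒uSum a-add (λ _ _ → refl)
                     (λ p k _ → cumulative-increments (λ k → a (p ^ k)) (additive-at-one a-add) (suc k))
      where
      f : ℕ → PS
      f p = increments (λ k → a (p ^ k))
    from : (Σ (ℕ → PS) λ f → (∀ p → Prime p → f p 0 ≈ 0#) × IsUTimesSum f a) → Additive a
    from (f , f0 , is) = sum-hom Coprime (coprime-additive-law f f0) is

  -- the cumulative sums of the f_p are the values of a at prime powers; the f_p are their increments
  uSum-unique : ∀ a f g →
    (∀ p → Prime p → f p 0 ≈ 0#) → IsUTimesSum f a → (∀ p → Prime p → g p 0 ≈ 0#) → IsUTimesSum g a →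
    ∀ p → Prime p → ∀ k → f p k ≈ g p k
  uSum-unique a f g f0 isf g0 isg p pp = same
    where
    p^k≥1 = ^-positive (prime≥1 pp)
    same-cumulative : ∀ k → cumulative (f p) k ≈ cumulative (g p) k
    same-cumulative k
      with instance-of (eventually-∧ (eventually-≥ (suc p))
                         (eventually-∧ (uSum-converges f a isf (p ^ k) (p^k≥1 k)) (uSum-converges g a isg (p ^ k) (p^k≥1 k))))
    ... | N , p<N , f→a , g→a = begin
      cumulative (f p) k ≈⟨ sym (uSum-prime-power f f0 pp N p<N k) ⟩
      uSum f N (p ^ k)   ≈⟨ f→a ⟩
      a (p ^ k)          ≈⟨ sym g→a ⟩
      uSum g N (p ^ k)   ≈⟨ uSum-prime-power g g0 pp N p<N k ⟩
      cumulative (g p) k ∎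
    same : ∀ k → f p k ≈ g p k
    same zero    = trans (f0 p pp) (sym (g0 p pp))
    same (suc k) = ∙-cancelˡ (cumulative (f p) k) _ _
      (trans (same-cumulative (suc k)) (+-congʳ (sym (same-cumulative k))))

  completelyAdditive⇔linear : ∀ a → CompletelyAdditive a ⟺
    (Σ (ℕ → Carrier) λ cs → IsUTimesSum (λ p → cxOver1-x (cs p)) a)
  completelyAdditive⇔linear a = to , from
    where
    to : CompletelyAdditive a → Σ (ℕ → Carrier) λ cs → IsUTimesSum (λ p → cxOver1-x (cs p)) a
    to a-add = a , additive⇒uSum (λ m n hm hn _ → a-add m n hm hn) (λ _ _ → refl)
      (λ p k pp → completely-additive-powers a-add (prime≥1 pp) (suc k))
    from : (Σ (ℕ → Carrier) λ cs → IsUTimesSum (λ p → cxOver1-x (cs p)) a) → CompletelyAdditive a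
    from (cs , is) m n hm hn =
      sum-hom Always (λ p _ _ sx sy → cumulative-linear (cs p) (exp sx) (exp sy)) is m n hm hn tt

mainTheorem3 : ∀ {c ℓ} (R : CommutativeRing c ℓ) →
  let open CommutativeRing R
      open Series R
  in
  -- (1) multiplicative ⇔ product of one-variable series with constant term 1
  (∀ (a : Arith) → Multiplicative a ⟺
      (Σ (ℕ → PS) λ f → (∀ p → Prime p → f p 0 ≈ 1#) × IsInfProd f a))
  -- (1) uniqueness of the f_i
  × (∀ (a : Arith) (f g : ℕ → PS) →
      (∀ p → Prime p → f p 0 ≈ 1#) → IsInfProd f a →
      (∀ p → Prime p → g p 0 ≈ 1#) → IsInfProd g a →
      ∀ p → Prime p → ∀ k → f p k ≈ g p k)
  -- (1) completely multiplicative ⇔ a = Π 1 / (1 - c_i x_i)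
  × (∀ (a : Arith) → CompletelyMultiplicative a ⟺
      (Σ (ℕ → Carrier) λ cs → IsInfProd (λ p → geomPS (cs p)) a))
  -- (2) additive ⇔ a = u · Σ f_i(x_i) with constant terms 0
  × (∀ (a : Arith) → Additive a ⟺
      (Σ (ℕ → PS) λ f → (∀ p → Prime p → f p 0 ≈ 0#) × IsUTimesSum f a))
  -- (2) uniqueness of the f_i
  × (∀ (a : Arith) (f g : ℕ → PS) →
      (∀ p → Prime p → f p 0 ≈ 0#) → IsUTimesSum f a →
      (∀ p → Prime p → g p 0 ≈ 0#) → IsUTimesSum g a →
      ∀ p → Prime p → ∀ k → f p k ≈ g p k)
  -- (2) completely additive ⇔ a = u · Σ c_i x_i / (1 - x_i)
  × (∀ (a : Arith) → CompletelyAdditive a ⟺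
      (Σ (ℕ → Carrier) λ cs → IsUTimesSum (λ p → cxOver1-x (cs p)) a))
mainTheorem3 R =
    multiplicative⇔product
  , product-unique
  , completelyMultiplicative⇔geometric
  , additive⇔uSum
  , uSum-unique
  , completelyAdditive⇔linear
  where open Coefficients R
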